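{- Let $G=(V,E)$ be a connected graph with $|V|\ge 3$, and let $E'$ be a minimum-size $(3,1)$-completion set of $G$. Then for every edge $e'\in E'$ there is a triangle in $G\cup E'$ containing $e'$ such that at least one edge of this triangle belongs to $E$ and is unsaturated in $G$, i.e., is contained in no triangle of $G$.
   Context: A connected graph has a $(3,1)$-cover if each of its edges lies in at least one triangle. For $G=(V,E)$, a set $E'$ of non-edges of $G$ is a $(3,1)$-completion set if $(V,E\cup E')$ has a $(3,1)$-cover; $G\cup E'$ denotes $(V,E\cup E')$. -}

module Defs where

open import Data.Nat using (ℕ; suc; _+_; _≤_; _<_)
open import Data.Fin using (Fin; toℕ)
open import Data.Bool using (Bool; true; false; _∨_; if_then_else_)
open import Data.List using (List; []; _∷_; map; allFin)
open import Data.Nat.ListAction using (sum)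
open import Data.List using (concatMap)
open import Data.Product using (Σ; ∃; _×_; _,_)
open import Data.Sum using (_⊎_)
open import Relation.Binary.PropositionalEquality using (_≡_; _≢_)

record Graph (n : ℕ) : Set where
  field
    adj    : Fin n → Fin n → Bool
    sym    : ∀ u v → adj u v ≡ adj v u
    irrefl : ∀ v → adj v v ≡ false
open Graph public

Adj : ∀ {n} → (Fin n → Fin n → Bool) → Fin n → Fin n → Set
Adj a u v = a u v ≡ true

data Walk {n : ℕ} (a : Fin n → Fin n → Bool) : Fin n → Fin n → Set where
  here : ∀ {u} → Walk a u u
  step : ∀ {u w v} → Adj a u w → Walk a w v → Walk a u v

Connected : ∀ {n} → Graph n → Set
Connected G = ∀ u v → Walk (adj G) u v

InTriangle : ∀ {n} → (Fin n → Fin n → Bool) → Fin n → Fin n → Set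
InTriangle a u v = ∃ λ w → Adj a u w × Adj a w v

Has31Cover : ∀ {n} → (Fin n → Fin n → Bool) → Set
Has31Cover a = ∀ u v → Adj a u v → InTriangle a u v

_∪E_ : ∀ {n} → Graph n → (Fin n → Fin n → Bool) → Fin n → Fin n → Bool
(G ∪E E') u v = adj G u v ∨ E' u v

NonEdgeSet : ∀ {n} → Graph n → (Fin n → Fin n → Bool) → Set
NonEdgeSet G E' =
  (∀ u v → E' u v ≡ E' v u) ×
  (∀ v → E' v v ≡ false) ×
  (∀ u v → Adj E' u v → adj G u v ≡ false)

CompletionSet : ∀ {n} → Graph n → (Fin n → Fin n → Bool) → Set
CompletionSet G E' = NonEdgeSet G E' × Has31Cover (G ∪E E')

size : ∀ {n} → (Fin n → Fin n → Bool) → ℕ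
size {n} E' =
  sum (concatMap (λ u → map (λ v → cnt u v) (allFin n)) (allFin n))
  where
  open import Data.Nat using (_<ᵇ_)
  open import Data.Bool using (_∧_)
  cnt : Fin n → Fin n → ℕ
  cnt u v = if (toℕ u <ᵇ toℕ v) ∧ E' u v then 1 else 0

MinCompletionSet : ∀ {n} → Graph n → (Fin n → Fin n → Bool) → Set
MinCompletionSet G E' =
  CompletionSet G E' × (∀ F → CompletionSet G F → size E' ≤ size F)

Unsaturated : ∀ {n} → Graph n → Fin n → Fin n → Set
Unsaturated G u v = Adj (adj G) u v × (InTriangle (adj G) u v → ⊥')
  where open import Data.Empty renaming (⊥ to ⊥')

{-# OPTIONS --safe #-}
-- Keep only those edges of E' that lie on a triangle of G ∪ E' having an
-- unsaturated edge of G. This pruned set is still a (3,1)-completion set: a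
-- saturated edge of G keeps its triangle in G; an unsaturated edge xy of G
-- keeps its triangle xwy of G ∪ E', because xy itself certifies the edges xw
-- and wy; and a kept edge xy has a triangle xwy with, say, xw an unsaturated
-- edge of G, which in turn certifies wy. So a minimum completion set loses
-- no edge by pruning.
module Submission where

open import Defs
open import Data.Nat using (ℕ; _≥_; _≤_; _<_; _+_; _<ᵇ_; z≤n)
open import Data.Nat.Properties using (≤-refl; +-mono-≤; +-mono-<-≤; +-mono-≤-<; <⇒<ᵇ; <⇒≱)
open import Data.Nat.ListAction using (sum)
open import Data.Nat.ListAction.Properties using (sum-++)
open import Data.Fin using (Fin; toℕ)
open import Data.Fin.Properties using (<-cmp; any?)
open import Data.Bool using (Bool; true; false; _∧_; _∨_; if_then_else_)
open import Data.Bool.Properties using (_≟_; ∨-zeroʳ; ¬-not; not-¬; T-≡)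
open import Data.List using (List; []; _∷_; map; allFin; concatMap)
open import Data.List.Membership.Propositional using (_∈_)
open import Data.List.Membership.Propositional.Properties using (∈-allFin)
open import Data.List.Relation.Unary.Any using (here; there)
open import Data.Product using (∃; _×_; _,_; proj₁; proj₂)
open import Data.Sum using (_⊎_; inj₁; inj₂)
open import Function using (_∘_; mk⇔; Equivalence)
open import Relation.Binary.Core using (_⇒_)
open import Relation.Binary.Definitions using (Symmetric; Decidable; tri<; tri≈; tri>)
open import Relation.Binary.PropositionalEquality using (_≡_; refl; trans; cong; cong₂)
open import Relation.Nullary using (¬_; does; yes; no; contradiction; ¬?; _×-dec_; _⊎-dec_)
open import Relation.Nullary.Decidable using (dec-true; does-⇔; decidable-stable)

private
  variable
    n : ℕ
    u v w x y : Fin n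

Adj-sym : {a : Fin n → Fin n → Bool} → (∀ u v → a u v ≡ a v u) → Symmetric (Adj a)
Adj-sym a-sym {u} {v} = trans (a-sym v u)

Adj? : (a : Fin n → Fin n → Bool) → Decidable (Adj a)
Adj? a u v = a u v ≟ true

module _ (G : Graph n) {E : Fin n → Fin n → Bool} where

  ∪E-inj₁ : Adj (adj G) u v → Adj (G ∪E E) u v
  ∪E-inj₁ g rewrite g = refl

  ∪E-inj₂ : Adj E u v → Adj (G ∪E E) u v
  ∪E-inj₂ {u} {v} e rewrite e = ∨-zeroʳ (adj G u v)

  ∪E-case : Adj (G ∪E E) u v → Adj (adj G) u v ⊎ Adj E u v
  ∪E-case {u} {v} a with adj G u v
  ... | true  = inj₁ refl
  ... | false = inj₂ a

  ∪E-sym : (∀ u v → E u v ≡ E v u) → Symmetric (Adj (G ∪E E))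
  ∪E-sym E-sym = Adj-sym λ u v → cong₂ _∨_ (Graph.sym G u v) (E-sym u v)

restrict : {P : Fin n → Fin n → Set} →
  (Fin n → Fin n → Bool) → Decidable P → Fin n → Fin n → Bool
restrict E P? u v = E u v ∧ does (P? u v)

module _ {E : Fin n → Fin n → Bool} {P : Fin n → Fin n → Set} (P? : Decidable P) where

  restrict⁺ : Adj E u v → P u v → Adj (restrict E P?) u v
  restrict⁺ {u} {v} e p rewrite e | dec-true (P? u v) p = refl

  restrict⁻ : Adj (restrict E P?) u v → Adj E u v × P u v
  restrict⁻ {u} {v} r with E u v | P? u v
  ... | true  | yes p = refl , p
  ... | true  | no _  = contradiction r λ ()
  ... | false | _     = contradiction r λ ()

  restrict-irrefl : (∀ v → E v v ≡ false) → ∀ v → restrict E P? v v ≡ false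
  restrict-irrefl E-irrefl v = cong (_∧ does (P? v v)) (E-irrefl v)

  restrict-sym : (∀ u v → E u v ≡ E v u) → Symmetric P →
    ∀ u v → restrict E P? u v ≡ restrict E P? v u
  restrict-sym E-sym P-sym u v =
    cong₂ _∧_ (E-sym u v) (does-⇔ (mk⇔ P-sym P-sym) (P? u v) (P? v u))

module _ {A : Set} {f g : A → ℕ} (f≤g : ∀ x → f x ≤ g x) where

  sum-map-mono-≤ : ∀ xs → sum (map f xs) ≤ sum (map g xs)
  sum-map-mono-≤ []       = z≤n
  sum-map-mono-≤ (x ∷ xs) = +-mono-≤ (f≤g x) (sum-map-mono-≤ xs)

  sum-map-mono-< : ∀ {y xs} → y ∈ xs → f y < g y → sum (map f xs) < sum (map g xs)
  sum-map-mono-< {xs = x ∷ xs} (here refl) fy<gy = +-mono-<-≤ fy<gy (sum-map-mono-≤ xs)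
  sum-map-mono-< {xs = x ∷ xs} (there y∈xs) fy<gy = +-mono-≤-< (f≤g x) (sum-map-mono-< y∈xs fy<gy)

sum-concatMap : {A : Set} (f : A → List ℕ) (xs : List A) →
  sum (concatMap f xs) ≡ sum (map (sum ∘ f) xs)
sum-concatMap f []       = refl
sum-concatMap f (x ∷ xs) =
  trans (sum-++ (f x) (concatMap f xs)) (cong (sum (f x) +_) (sum-concatMap f xs))

pairCount : (Fin n → Fin n → Bool) → Fin n → Fin n → ℕ
pairCount E u v = if (toℕ u <ᵇ toℕ v) ∧ E u v then 1 else 0

size-as-double-sum : (E : Fin n → Fin n → Bool) →
  size E ≡ sum (map (λ u → sum (map (pairCount E u) (allFin n))) (allFin n))
size-as-double-sum {n} E = sum-concatMap (λ u → map (pairCount E u) (allFin n)) (allFin n)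

module _ {F E : Fin n → Fin n → Bool} (F⊆E : Adj F ⇒ Adj E) where

  pairCount-mono : ∀ u v → pairCount F u v ≤ pairCount E u v
  pairCount-mono u v with toℕ u <ᵇ toℕ v | F u v in Fuv
  ... | false | _     = z≤n
  ... | true  | false = z≤n
  ... | true  | true rewrite F⊆E Fuv = ≤-refl

  pairCount-< : toℕ u < toℕ v → Adj E u v → ¬ Adj F u v → pairCount F u v < pairCount E u v
  pairCount-< u<v Euv ¬Fuv
    rewrite Equivalence.to T-≡ (<⇒<ᵇ u<v) | Euv | ¬-not ¬Fuv = ≤-refl

  size-<-ordered : toℕ u < toℕ v → Adj E u v → ¬ Adj F u v → size F < size E
  size-<-ordered {u} {v} u<v Euv ¬Fuv
    rewrite size-as-double-sum F | size-as-double-sum E =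
    sum-map-mono-< (λ x → sum-map-mono-≤ (pairCount-mono x) (allFin n)) (∈-allFin u)
      (sum-map-mono-< (pairCount-mono u) (∈-allFin v) (pairCount-< u<v Euv ¬Fuv))

  size-< : (∀ u v → E u v ≡ E v u) → (∀ v → E v v ≡ false) → Symmetric (Adj F) →
    Adj E u v → ¬ Adj F u v → size F < size E
  size-< {u} {v} E-sym E-irrefl F-sym Euv ¬Fuv with <-cmp u v
  ... | tri< u<v _ _ = size-<-ordered u<v Euv ¬Fuv
  ... | tri≈ _ refl _ = contradiction (E-irrefl u) (not-¬ Euv)
  ... | tri> _ _ v<u = size-<-ordered v<u (Adj-sym E-sym Euv) (¬Fuv ∘ F-sym)

inTriangle? : (a : Fin n → Fin n → Bool) → Decidable (InTriangle a)
inTriangle? a u v = any? λ w → Adj? a u w ×-dec Adj? a w v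

InTriangle-sym : {a : Fin n → Fin n → Bool} → Symmetric (Adj a) → Symmetric (InTriangle a)
InTriangle-sym a-sym (w , uw , wv) = w , a-sym wv , a-sym uw

module _ (G : Graph n) where

  Unsaturated-sym : Symmetric (Unsaturated G)
  Unsaturated-sym (uv , ¬t) = G-sym uv , λ t → ¬t (InTriangle-sym {a = adj G} G-sym t)
    where
    G-sym : Symmetric (Adj (adj G))
    G-sym = Adj-sym (Graph.sym G)

  unsaturated? : Decidable (Unsaturated G)
  unsaturated? u v = Adj? (adj G) u v ×-dec ¬? (inTriangle? (adj G) u v)

  OnUnsaturatedTriangle : (Fin n → Fin n → Bool) → Fin n → Fin n → Set
  OnUnsaturatedTriangle a u v =
    ∃ λ w → Adj a u w × Adj a w v × (Unsaturated G u w ⊎ Unsaturated G w v)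

  onUnsaturatedTriangle? : (a : Fin n → Fin n → Bool) → Decidable (OnUnsaturatedTriangle a)
  onUnsaturatedTriangle? a u v = any? λ w →
    Adj? a u w ×-dec Adj? a w v ×-dec (unsaturated? u w ⊎-dec unsaturated? w v)

  OnUnsaturatedTriangle-sym : {a : Fin n → Fin n → Bool} → Symmetric (Adj a) →
    Symmetric (OnUnsaturatedTriangle a)
  OnUnsaturatedTriangle-sym a-sym (w , uw , wv , inj₁ uw-unsat) =
    w , a-sym wv , a-sym uw , inj₂ (Unsaturated-sym uw-unsat)
  OnUnsaturatedTriangle-sym a-sym (w , uw , wv , inj₂ wv-unsat) =
    w , a-sym wv , a-sym uw , inj₁ (Unsaturated-sym wv-unsat)

  prune : (Fin n → Fin n → Bool) → Fin n → Fin n → Bool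
  prune E' = restrict E' (onUnsaturatedTriangle? (G ∪E E'))

  module _ {E' : Fin n → Fin n → Bool} where

    prune⁺ : Adj E' u v → OnUnsaturatedTriangle (G ∪E E') u v → Adj (prune E') u v
    prune⁺ = restrict⁺ {E = E'} (onUnsaturatedTriangle? (G ∪E E'))

    prune⁻ : Adj (prune E') u v → Adj E' u v × OnUnsaturatedTriangle (G ∪E E') u v
    prune⁻ = restrict⁻ {E = E'} (onUnsaturatedTriangle? (G ∪E E'))

    prune-irrefl : (∀ v → E' v v ≡ false) → ∀ v → prune E' v v ≡ false
    prune-irrefl = restrict-irrefl {E = E'} (onUnsaturatedTriangle? (G ∪E E'))

    prune-sym : (∀ u v → E' u v ≡ E' v u) → ∀ u v → prune E' u v ≡ prune E' v u
    prune-sym E'-sym = restrict-sym {E = E'} (onUnsaturatedTriangle? (G ∪E E')) E'-sym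
      (OnUnsaturatedTriangle-sym (∪E-sym G E'-sym))

module _ {G : Graph n} {E' : Fin n → Fin n → Bool} (E'-sym : ∀ u v → E' u v ≡ E' v u) where

  private
    A B : Fin n → Fin n → Bool
    A = G ∪E E'
    B = G ∪E prune G E'

    G⇒A : Adj (adj G) ⇒ Adj A
    G⇒A = ∪E-inj₁ G {E'}

    E'⇒A : Adj E' ⇒ Adj A
    E'⇒A = ∪E-inj₂ G {E'}

    G⇒B : Adj (adj G) ⇒ Adj B
    G⇒B = ∪E-inj₁ G {prune G E'}

    prune⇒B : Adj (prune G E') ⇒ Adj B
    prune⇒B = ∪E-inj₂ G {prune G E'}

    A-sym : Symmetric (Adj A)
    A-sym = ∪E-sym G E'-sym

    B-sym : Symmetric (Adj B)
    B-sym = ∪E-sym G (prune-sym G E'-sym)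

  onUnsaturatedTriangle⇒prune : Adj A x y → OnUnsaturatedTriangle G A x y → Adj B x y
  onUnsaturatedTriangle⇒prune xy t with ∪E-case G {E'} xy
  ... | inj₁ g = G⇒B g
  ... | inj₂ e = prune⇒B (prune⁺ G e t)

  unsaturated-triangle⇒prune : Unsaturated G x y → Adj A x w → Adj A w y →
    Adj B x w × Adj B w y
  unsaturated-triangle⇒prune {x} {y} xy-unsat xw wy =
    onUnsaturatedTriangle⇒prune xw (y , xy , A-sym wy , inj₁ xy-unsat) ,
    onUnsaturatedTriangle⇒prune wy (x , A-sym xw , xy , inj₂ xy-unsat)
    where
    xy : Adj A x y
    xy = G⇒A (proj₁ xy-unsat)

  prune-cover : Has31Cover A → Has31Cover B
  prune-cover A-cover x y xy with ∪E-case G {prune G E'} xy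
  ... | inj₁ g with inTriangle? (adj G) x y
  ...   | yes (w , xw , wy) = w , G⇒B xw , G⇒B wy
  ...   | no ¬t with A-cover x y (G⇒A g)
  ...     | w , xw , wy = w , unsaturated-triangle⇒prune (g , ¬t) xw wy
  prune-cover A-cover x y xy | inj₂ f with prune⁻ G {E'} f
  ... | e , (w , xw , wy , inj₁ xw-unsat) =
    w , G⇒B (proj₁ xw-unsat) ,
    B-sym (proj₂ (unsaturated-triangle⇒prune xw-unsat (E'⇒A e) (A-sym wy)))
  ... | e , (w , xw , wy , inj₂ wy-unsat) =
    w , B-sym (proj₁ (unsaturated-triangle⇒prune wy-unsat (A-sym xw) (E'⇒A e))) ,
    G⇒B (proj₁ wy-unsat)

prune-completion : {G : Graph n} {E' : Fin n → Fin n → Bool} →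
  CompletionSet G E' → CompletionSet G (prune G E')
prune-completion {G = G} {E'} ((E'-sym , E'-irrefl , E'-disjoint) , cover) =
  (prune-sym G E'-sym , prune-irrefl G E'-irrefl ,
   (λ u v uv → E'-disjoint u v (proj₁ (prune⁻ G {E'} uv)))) ,
  prune-cover {G = G} E'-sym cover

size-prune-< : {G : Graph n} {E' : Fin n → Fin n → Bool} → NonEdgeSet G E' →
  Adj E' u v → ¬ OnUnsaturatedTriangle G (G ∪E E') u v → size (prune G E') < size E'
size-prune-< {G = G} {E'} (E'-sym , E'-irrefl , _) uv ¬t =
  size-< (λ f → proj₁ (prune⁻ G {E'} f)) E'-sym E'-irrefl (Adj-sym (prune-sym G E'-sym)) uv
    (λ f → ¬t (proj₂ (prune⁻ G {E'} f)))

lemma11 : (n : ℕ) → n ≥ 3 → (G : Graph n) → Connected G →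
    (E' : Fin n → Fin n → Bool) → MinCompletionSet G E' →
    ∀ u v → Adj E' u v →
    ∃ λ w → Adj (G ∪E E') u w × Adj (G ∪E E') w v ×
      (Unsaturated G u w ⊎ Unsaturated G w v)
lemma11 n _ G _ E' (E'-completion , minimal) u v uv =
  decidable-stable (onUnsaturatedTriangle? G (G ∪E E') u v) λ ¬t →
    <⇒≱ (size-prune-< {G = G} (proj₁ E'-completion) uv ¬t)
        (minimal (prune G E') (prune-completion {G = G} E'-completion))
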